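{- Let $G$ be a graph with no isolated vertex and let $H$ be a nontrivial graph (at least two vertices) such that $\gamma_I(H)\neq 3$ or $\gamma(H)\neq 3$. Then there exists an Italian dominating function $f$ on $G\circ H$ of minimum weight $\omega(f)=\gamma_I(G\circ H)$ such that $f(V(H_u))=\sum_{y\in V(H)} f(u,y)\le 2$ for every $u\in V(G)$.
   Context: All graphs are finite and simple. $N(v)$ denotes the open neighbourhood of $v$, and for a function $f$ on vertices and a set $S$, $f(S)=\sum_{u\in S}f(u)$; the weight of $f$ is $\omega(f)=f(V)$. An Italian dominating function (IDF) on a graph is a function $f:V\to\{0,1,2\}$ with $f(N(v))\ge 2$ for every vertex $v$ with $f(v)=0$; $\gamma_I$ is the minimum weight of an IDF. $\gamma(H)$ is the domination number of $H$. The lexicographic product $G\circ H$ has vertex set $V(G)\times V(H)$, with $(u,v)(x,y)$ an edge iff $ux\in E(G)$, or $u=x$ and $vy\in E(H)$. For $u\in V(G)$, $H_u$ denotes the subgraph of $G\circ H$ induced by $\{u\}\times V(H)$. -}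

module Defs where

open import Data.Nat using (ℕ; zero; suc; _+_; _*_; _≤_)
open import Data.Fin using (Fin; zero; suc; combine; remQuot)
open import Data.Bool using (Bool; true; false; if_then_else_; _∨_; _∧_)
open import Data.Product using (Σ; ∃; _×_; _,_)
open import Relation.Binary.PropositionalEquality using (_≡_; refl)

record Graph : Set where
  field
    n      : ℕ
    adj    : Fin n → Fin n → Bool
    sym    : ∀ i j → adj i j ≡ adj j i
    irrefl : ∀ i → adj i i ≡ false
open Graph public

ΣF : (n : ℕ) → (Fin n → ℕ) → ℕ
ΣF zero    g = 0
ΣF (suc n) g = g zero + ΣF n (λ i → g (suc i))

nbSum : (G : Graph) → (Fin (n G) → ℕ) → Fin (n G) → ℕ
nbSum G f v = ΣF (n G) (λ u → if adj G v u then f u else 0)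

weight : (G : Graph) → (Fin (n G) → ℕ) → ℕ
weight G f = ΣF (n G) f

IsIDF : (G : Graph) → (Fin (n G) → ℕ) → Set
IsIDF G f = (∀ v → f v ≤ 2) × (∀ v → f v ≡ 0 → 2 ≤ nbSum G f v)

IsMinIDF : (G : Graph) → (Fin (n G) → ℕ) → Set
IsMinIDF G f = IsIDF G f × (∀ g → IsIDF G g → weight G f ≤ weight G g)

ItalianDominationNumber : Graph → ℕ → Set
ItalianDominationNumber G k = Σ (Fin (n G) → ℕ) λ f → IsMinIDF G f × weight G f ≡ k

IsDominating : (G : Graph) → (Fin (n G) → Bool) → Set
IsDominating G D = ∀ v → D v ≡ false → ∃ λ u → (adj G v u ≡ true) × (D u ≡ true)

card : (G : Graph) → (Fin (n G) → Bool) → ℕ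
card G D = ΣF (n G) (λ v → if D v then 1 else 0)

DominationNumber : Graph → ℕ → Set
DominationNumber G k =
  Σ (Fin (n G) → Bool) λ D → IsDominating G D × card G D ≡ k
    × (∀ D′ → IsDominating G D′ → k ≤ card G D′)

NoIsolatedVertex : Graph → Set
NoIsolatedVertex G = ∀ u → ∃ λ v → adj G u v ≡ true

eqF : ∀ {m} → Fin m → Fin m → Bool
eqF zero    zero    = true
eqF (suc a) (suc b) = eqF a b
eqF zero    (suc _) = false
eqF (suc _) zero    = false

eqF-sym : ∀ {m} (a b : Fin m) → eqF a b ≡ eqF b a
eqF-sym zero    zero    = refl
eqF-sym (suc a) (suc b) = eqF-sym a b
eqF-sym zero    (suc _) = refl
eqF-sym (suc _) zero    = refl

eqF-refl : ∀ {m} (a : Fin m) → eqF a a ≡ true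
eqF-refl zero    = refl
eqF-refl (suc a) = eqF-refl a

lexAdj′ : (G H : Graph) → (Fin (n G) × Fin (n H)) → (Fin (n G) × Fin (n H)) → Bool
lexAdj′ G H (u , v) (x , y) = adj G u x ∨ (eqF u x ∧ adj H v y)

lexAdj′-sym : (G H : Graph) → ∀ p q → lexAdj′ G H p q ≡ lexAdj′ G H q p
lexAdj′-sym G H (u , v) (x , y)
  rewrite sym G u x | eqF-sym u x | sym H v y = refl

lexAdj′-irrefl : (G H : Graph) → ∀ p → lexAdj′ G H p p ≡ false
lexAdj′-irrefl G H (u , v) rewrite irrefl G u | eqF-refl u | irrefl H v = refl

-- Lexicographic product G ∘ H. Vertex (u,y) of V(G) × V(H) is encoded as
-- combine u y : Fin (n G * n H) (remQuot is its inverse).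
_∘ₗ_ : Graph → Graph → Graph
G ∘ₗ H = record
  { n      = n G * n H
  ; adj    = λ p q → lexAdj′ G H (remQuot (n H) p) (remQuot (n H) q)
  ; sym    = λ p q → lexAdj′-sym G H (remQuot (n H) p) (remQuot (n H) q)
  ; irrefl = λ p → lexAdj′-irrefl G H (remQuot (n H) p)
  }

-- Among the minimum-weight IDFs of G ∘ H choose one, f, with the fewest heavy fibres, i.e. fibres
-- H_u with f(V(H_u)) ≥ 3 (a finite minimisation). Suppose H_u is heavy and x is a neighbour of u.
-- Every vertex of H_u sees all of each neighbouring fibre, and every vertex of a neighbouring
-- fibre sees all of H_u. Hence f can be replaced on H_u by a function of weight 2, possibly
-- raising it on H_x, without losing the Italian property or increasing the weight: put 2 on one
-- vertex of H_u when the neighbouring fibres carry weight ≥ 2, and also 2 on one vertex of H_x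
-- when they carry weight 1 or f(V(H_u)) ≥ 4; otherwise use an IDF of H of weight 2, or a
-- dominating set of H of size 2 together with weight 1 in H_x. Each such exchange lowers the
-- number of heavy fibres, so none applies. Then the neighbouring fibres are empty,
-- f(V(H_u)) = 3, and f restricted to H_u is an IDF of H whose weight 3 is minimum and whose
-- support is a minimum dominating set: γ_I(H) = γ(H) = 3.
module Submission where

open import Defs hiding (sym)
open import Data.Nat using (ℕ; zero; suc; _+_; _*_; _^_; _≤_; _<_; z≤n; s≤s; _≤?_; _≟_)
open import Data.Nat.Properties
open import Data.Nat.Induction using (<-rec)
open import Data.Nat.Tactic.RingSolver using (solve-∀)
open import Data.Fin as Fin
  using (Fin; zero; suc; combine; remQuot; toℕ; fromℕ<; finToFun; funToFin; _↑ˡ_; _↑ʳ_)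
open import Data.Fin.Properties
  using (any?; all?; toℕ-fromℕ<; finToFun-funToFin; remQuot-combine; combine-remQuot)
open import Data.Vec.Functional using (updateAt)
open import Data.Vec.Functional.Properties using (updateAt-updates; updateAt-minimal; updateAt-id-local)
open import Data.Bool using (Bool; true; false; if_then_else_)
open import Data.Product using (Σ; ∃; _×_; _,_; proj₁; proj₂; uncurry)
open import Data.Sum using (_⊎_; [_,_])
open import Data.Empty using (⊥-elim)
open import Function using (_∘_; const)
open import Relation.Binary.PropositionalEquality
  using (_≡_; _≢_; _≗_; refl; sym; trans; cong; cong₂; subst; module ≡-Reasoning)
open import Relation.Nullary using (¬_; Dec; yes; no; contradiction)
open import Relation.Nullary.Decidable using (_×-dec_; _→-dec_)
open import Relation.Unary using (Decidable)

infixl 6 _[_≔_]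

_[_≔_] : ∀ {A : Set} {n} → (Fin n → A) → Fin n → A → Fin n → A
xs [ i ≔ a ] = updateAt xs i (const a)

[≔]-elim : ∀ {A : Set} {n} (P : Fin n → A → Set) (xs : Fin n → A) i a →
           P i a → (∀ j → j ≢ i → P j (xs j)) → ∀ j → P j ((xs [ i ≔ a ]) j)
[≔]-elim P xs i a Pᵢ P-off j with j Fin.≟ i
... | yes refl = subst (P j) (sym (updateAt-updates j {const a} xs)) Pᵢ
... | no j≢i   = subst (P j) (sym (updateAt-minimal j i {const a} xs j≢i)) (P-off j j≢i)

ΣF-cong : ∀ n {g h : Fin n → ℕ} → g ≗ h → ΣF n g ≡ ΣF n h
ΣF-cong zero    g≗h = refl
ΣF-cong (suc n) g≗h = cong₂ _+_ (g≗h zero) (ΣF-cong n (g≗h ∘ suc))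

ΣF-mono : ∀ n {g h : Fin n → ℕ} → (∀ i → g i ≤ h i) → ΣF n g ≤ ΣF n h
ΣF-mono zero    g≤h = z≤n
ΣF-mono (suc n) g≤h = +-mono-≤ (g≤h zero) (ΣF-mono n (g≤h ∘ suc))

ΣF-zero : ∀ n → ΣF n (λ _ → 0) ≡ 0
ΣF-zero zero    = refl
ΣF-zero (suc n) = ΣF-zero n

term≤ΣF : ∀ n (g : Fin n → ℕ) i → g i ≤ ΣF n g
term≤ΣF (suc n) g zero    = m≤m+n _ _
term≤ΣF (suc n) g (suc i) = ≤-trans (term≤ΣF n (g ∘ suc) i) (m≤n+m _ _)

terms≤ΣF : ∀ n (g : Fin n → ℕ) {i j} → i ≢ j → g i + g j ≤ ΣF n g
terms≤ΣF (suc n) g {zero}  {zero}  0≢0 = contradiction refl 0≢0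
terms≤ΣF (suc n) g {zero}  {suc j} _   = +-monoʳ-≤ (g zero) (term≤ΣF n (g ∘ suc) j)
terms≤ΣF (suc n) g {suc i} {zero}  _   =
  subst (_≤ ΣF (suc n) g) (+-comm (g zero) (g (suc i))) (+-monoʳ-≤ (g zero) (term≤ΣF n (g ∘ suc) i))
terms≤ΣF (suc n) g {suc i} {suc j} i≢j =
  ≤-trans (terms≤ΣF n (g ∘ suc) (i≢j ∘ cong suc)) (m≤n+m _ _)

ΣF-positive : ∀ n (g : Fin n → ℕ) → 1 ≤ ΣF n g → ∃ λ i → 1 ≤ g i
ΣF-positive (suc n) g pos with g zero in g₀
... | suc _ = zero , subst (1 ≤_) (sym g₀) (s≤s z≤n)
... | zero with ΣF-positive n (g ∘ suc) pos
...   | i , gᵢ = suc i , gᵢ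

ΣF-*ˡ : ∀ n c (g : Fin n → ℕ) → ΣF n (λ i → c * g i) ≡ c * ΣF n g
ΣF-*ˡ zero    c g = sym (*-zeroʳ c)
ΣF-*ˡ (suc n) c g =
  trans (cong (c * g zero +_) (ΣF-*ˡ n c (g ∘ suc))) (sym (*-distribˡ-+ c (g zero) _))

ΣF-[≔] : ∀ {A : Set} {n} (φ : A → ℕ) (xs : Fin n → A) i a →
         ΣF n (φ ∘ (xs [ i ≔ a ])) + φ (xs i) ≡ ΣF n (φ ∘ xs) + φ a
ΣF-[≔] φ xs zero    a = swap (φ a) (ΣF _ (φ ∘ xs ∘ suc)) (φ (xs zero))
  where
  swap : ∀ a s b → a + s + b ≡ b + s + a
  swap = solve-∀
ΣF-[≔] φ xs (suc i) a = begin
  x₀ + ΣF _ (φ ∘ ((xs ∘ suc) [ i ≔ a ])) + φ (xs (suc i))   ≡⟨ +-assoc x₀ _ _ ⟩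
  x₀ + (ΣF _ (φ ∘ ((xs ∘ suc) [ i ≔ a ])) + φ (xs (suc i))) ≡⟨ cong (x₀ +_) (ΣF-[≔] φ (xs ∘ suc) i a) ⟩
  x₀ + (ΣF _ (φ ∘ xs ∘ suc) + φ a)                         ≡⟨ +-assoc x₀ _ _ ⟨
  x₀ + ΣF _ (φ ∘ xs ∘ suc) + φ a                           ∎
  where
  open ≡-Reasoning
  x₀ = φ (xs zero)

ΣF-[≔]-concentrated : ∀ n (k : Fin n → ℕ) i a → ΣF n k ≡ k i → ΣF n (k [ i ≔ a ]) ≡ a
ΣF-[≔]-concentrated n k i a Σk≡kᵢ = +-cancelʳ-≡ (k i) _ a
  (trans (ΣF-[≔] (λ m → m) k i a) (trans (cong (_+ a) Σk≡kᵢ) (+-comm (k i) a)))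

point : ∀ {n} → Fin n → ℕ → Fin n → ℕ
point y c = (λ _ → 0) [ y ≔ c ]

point≤ : ∀ {n} (y : Fin n) c z → point y c z ≤ c
point≤ y c = [≔]-elim (λ _ m → m ≤ c) (λ _ → 0) y c ≤-refl (λ _ _ → z≤n)

ΣF-point : ∀ n (y : Fin n) c → ΣF n (point y c) ≡ c
ΣF-point n y c = ΣF-[≔]-concentrated n (λ _ → 0) y c (ΣF-zero n)

ΣF-++ : ∀ m n (g : Fin (m + n) → ℕ) →
        ΣF (m + n) g ≡ ΣF m (λ i → g (i ↑ˡ n)) + ΣF n (λ i → g (m ↑ʳ i))
ΣF-++ zero    n g = refl
ΣF-++ (suc m) n g = trans (cong (g zero +_) (ΣF-++ m n (g ∘ suc))) (sym (+-assoc (g zero) _ _))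

ΣF-combine : ∀ m n (g : Fin (m * n) → ℕ) → ΣF (m * n) g ≡ ΣF m (λ x → ΣF n (λ y → g (combine x y)))
ΣF-combine zero    n g = refl
ΣF-combine (suc m) n g =
  trans (ΣF-++ n (m * n) g) (cong (ΣF n (λ y → g (y ↑ˡ (m * n))) +_) (ΣF-combine m n (g ∘ (n ↑ʳ_))))

+-balance-≤ : ∀ {a b c d} → a + c ≡ b + d → d ≤ c → a ≤ b
+-balance-≤ {a} {b} {c} a+c≡b+d d≤c =
  +-cancelʳ-≤ c a b (subst (_≤ b + c) (sym a+c≡b+d) (+-monoʳ-≤ b d≤c))

+-balance-< : ∀ {a b c d} → a + c ≡ b + d → d < c → a < b
+-balance-< {a} {b} {c} a+c≡b+d d<c =
  +-cancelʳ-< c a b (subst (_< b + c) (sym a+c≡b+d) (+-monoʳ-< b d<c))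

ArgMin : {A : Set} → (A → Set) → (A → ℕ) → Set
ArgMin {A} P μ = Σ A λ a → P a × (∀ b → P b → μ a ≤ μ b)

least : ∀ {P : ℕ → Set} → Decidable P → ∀ {m} → P m → ArgMin P (λ k → k)
least {P} P? {m} = <-rec (λ m → P m → ArgMin P (λ k → k)) step m
  where
  step : ∀ m → (∀ {j} → j < m → P j → ArgMin P (λ k → k)) → P m → ArgMin P (λ k → k)
  step m below Pm with anyUpTo? P? m
  ... | yes (j , j<m , Pj) = below j<m Pj
  ... | no none            = m , Pm , λ j Pj → ≮⇒≥ λ j<m → none (j , j<m , Pj)

argmin : ∀ {K} {P : Fin K → Set} → Decidable P → (μ : Fin K → ℕ) → ∃ P → ArgMin P μ
argmin P? μ (i₀ , Pi₀) with least (λ k → any? (λ i → P? i ×-dec μ i ≤? k)) (i₀ , Pi₀ , ≤-refl)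
... | _ , (i , Pi , μi≤k) , minimal = i , Pi , λ j Pj → ≤-trans μi≤k (minimal _ (j , Pj , ≤-refl))

decodeBounded : ∀ {N} b → Fin (suc b ^ N) → Fin N → ℕ
decodeBounded b c = toℕ ∘ finToFun c

decodeBounded-surjective : ∀ {N} b (f : Fin N → ℕ) → (∀ i → f i ≤ b) → ∃ λ c → decodeBounded b c ≗ f
decodeBounded-surjective b f f≤b =
  funToFin (λ i → fromℕ< (s≤s (f≤b i))) ,
  λ i → trans (cong toℕ (finToFun-funToFin _ i)) (toℕ-fromℕ< _)

argmin-bounded : ∀ {N} b {Q : (Fin N → ℕ) → Set} → Decidable Q → (∀ {f g} → f ≗ g → Q f → Q g) →
                 (∀ {f} → Q f → ∀ i → f i ≤ b) →
                 (μ : (Fin N → ℕ) → ℕ) → (∀ {f g} → f ≗ g → μ f ≡ μ g) → ∃ Q → ArgMin Q μ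
argmin-bounded {N} b {Q} Q? Q-resp bounded μ μ-resp (f₀ , Qf₀) =
  minimiser (argmin (Q? ∘ decode) (μ ∘ decode) (proj₁ (code Qf₀) , proj₁ (proj₂ (code Qf₀))))
  where
  decode = decodeBounded b
  code : ∀ {f} → Q f → Σ (Fin (suc b ^ N)) λ c → Q (decode c) × μ (decode c) ≡ μ f
  code {f} Qf = let c , c≗f = decodeBounded-surjective b f (bounded Qf)
                in c , Q-resp (sym ∘ c≗f) Qf , μ-resp c≗f
  minimiser : ArgMin (Q ∘ decode) (μ ∘ decode) → ArgMin Q μ
  minimiser (c , Qc , minimal) = decode c , Qc , λ g Qg →
    let c′ , Qc′ , μc′≡μg = code Qg in subst (μ (decode c) ≤_) μc′≡μg (minimal c′ Qc′)

eqF-false : ∀ {m} {a b : Fin m} → a ≢ b → eqF a b ≡ false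
eqF-false {a = zero}  {zero}  a≢b = contradiction refl a≢b
eqF-false {a = zero}  {suc _} _   = refl
eqF-false {a = suc _} {zero}  _   = refl
eqF-false {a = suc a} {suc b} a≢b = eqF-false (a≢b ∘ cong suc)

twoVertices : ∀ {k} → 2 ≤ k → Σ (Fin k) λ a → Σ (Fin k) λ b → a ≢ b
twoVertices {suc (suc _)} _ = zero , suc zero , λ ()
twoVertices {suc zero} (s≤s ())

positive : ℕ → Bool
positive zero    = false
positive (suc _) = true

positive≡false : ∀ {m} → positive m ≡ false → m ≡ 0
positive≡false {zero} _ = refl

positive-≥1 : ∀ {m} → 1 ≤ m → positive m ≡ true
positive-≥1 (s≤s _) = refl

module _ (G : Graph) where

  adj⇒≢ : ∀ {v x} → adj G v x ≡ true → v ≢ x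
  adj⇒≢ {v} vx refl with trans (sym vx) (irrefl G v)
  ... | ()

  adj-≢ : ∀ {v x y} → adj G v x ≡ true → adj G v y ≡ false → x ≢ y
  adj-≢ vx vy refl with trans (sym vx) vy
  ... | ()

  nbSum-cong : ∀ {f f′} v → (∀ x → adj G v x ≡ true → f x ≡ f′ x) → nbSum G f v ≡ nbSum G f′ v
  nbSum-cong {f} {f′} v f≡f′ = ΣF-cong (n G) term
    where
    term : ∀ x → (if adj G v x then f x else 0) ≡ (if adj G v x then f′ x else 0)
    term x with adj G v x in vx
    ... | true  = f≡f′ x vx
    ... | false = refl

  neighbour≤nbSum : ∀ f {v x} → adj G v x ≡ true → f x ≤ nbSum G f v
  neighbour≤nbSum f {v} {x} vx =
    subst (_≤ nbSum G f v) (cong (if_then f x else 0) vx) (term≤ΣF (n G) _ x)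

  nbSum≤weight : ∀ f v → nbSum G f v ≤ weight G f
  nbSum≤weight f v = ΣF-mono (n G) term
    where
    term : ∀ x → (if adj G v x then f x else 0) ≤ f x
    term x with adj G v x
    ... | true  = ≤-refl
    ... | false = z≤n

  nbSum-positive : ∀ f v → 1 ≤ nbSum G f v → ∃ λ x → adj G v x ≡ true × 1 ≤ f x
  nbSum-positive f v pos with ΣF-positive (n G) _ pos
  ... | x , termₓ with adj G v x in vx
  ...   | true = x , vx , termₓ

  isIDF? : Decidable (IsIDF G)
  isIDF? f = all? (λ v → f v ≤? 2) ×-dec all? (λ v → (f v ≟ 0) →-dec (2 ≤? nbSum G f v))

  IsIDF-cong : ∀ {f f′} → f ≗ f′ → IsIDF G f → IsIDF G f′
  IsIDF-cong f≗f′ (bounded , dominated) =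
    (λ v → subst (_≤ 2) (f≗f′ v) (bounded v)) ,
    (λ v f′v≡0 → subst (2 ≤_) (nbSum-cong v λ x _ → f≗f′ x) (dominated v (trans (f≗f′ v) f′v≡0)))

  IDF-weight≥2 : 2 ≤ n G → ∀ {f} → IsIDF G f → 2 ≤ weight G f
  IDF-weight≥2 2≤n {f} (_ , dominated) with twoVertices 2≤n
  ... | a , b , a≢b with f a in fa | f b in fb
  ...   | zero  | _     = ≤-trans (dominated a fa) (nbSum≤weight f a)
  ...   | suc _ | zero  = ≤-trans (dominated b fb) (nbSum≤weight f b)
  ...   | suc _ | suc _ = ≤-trans (+-mono-≤ (positive-at fa) (positive-at fb)) (terms≤ΣF (n G) f a≢b)
    where
    positive-at : ∀ {v m} → f v ≡ suc m → 1 ≤ f v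
    positive-at fv = subst (1 ≤_) (sym fv) (s≤s z≤n)

  support : (Fin (n G) → ℕ) → Fin (n G) → Bool
  support f v = positive (f v)

  support-dominating : ∀ {f} → IsIDF G f → IsDominating G (support f)
  support-dominating {f} (_ , dominated) v fv≡0
    with nbSum-positive f v (≤-trans (s≤s z≤n) (dominated v (positive≡false fv≡0)))
  ... | x , vx , 1≤fx = x , vx , positive-≥1 1≤fx

  card-support≤weight : ∀ f → card G (support f) ≤ weight G f
  card-support≤weight f = ΣF-mono (n G) (indicator≤ ∘ f)
    where
    indicator≤ : ∀ m → (if positive m then 1 else 0) ≤ m
    indicator≤ zero    = z≤n
    indicator≤ (suc m) = s≤s z≤n

  twoOn : (Fin (n G) → Bool) → Fin (n G) → ℕ
  twoOn D v = if D v then 2 else 0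

  twoOn-IDF : ∀ {D} → IsDominating G D → IsIDF G (twoOn D)
  twoOn-IDF {D} dom = bounded , dominated
    where
    bounded : ∀ v → twoOn D v ≤ 2
    bounded v with D v
    ... | true  = ≤-refl
    ... | false = z≤n
    dominated : ∀ v → twoOn D v ≡ 0 → 2 ≤ nbSum G (twoOn D) v
    dominated v _ with D v in Dv
    ... | false with dom v Dv
    ...   | x , vx , Dx =
      ≤-trans (≤-reflexive (cong (if_then 2 else 0) (sym Dx))) (neighbour≤nbSum (twoOn D) vx)

  twoOn-weight≤2 : ∀ D → card G D ≤ 1 → weight G (twoOn D) ≤ 2
  twoOn-weight≤2 D |D|≤1 =
    ≤-trans (≤-reflexive (trans (ΣF-cong (n G) twice) (ΣF-*ˡ (n G) 2 _))) (*-monoʳ-≤ 2 |D|≤1)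
    where
    twice : ∀ v → twoOn D v ≡ 2 * (if D v then 1 else 0)
    twice v with D v
    ... | true  = refl
    ... | false = refl

isHeavy : ℕ → ℕ
isHeavy (suc (suc (suc _))) = 1
isHeavy _                   = 0

isHeavy-≥3 : ∀ {m} → 3 ≤ m → isHeavy m ≡ 1
isHeavy-≥3 (s≤s (s≤s (s≤s _))) = refl

module LexProduct (G H : Graph) where

  Labelling : Set
  Labelling = Fin (n G) → Fin (n H) → ℕ

  cur : (Fin (n (G ∘ₗ H)) → ℕ) → Labelling
  cur f u y = f (combine u y)

  uncur : Labelling → Fin (n (G ∘ₗ H)) → ℕ
  uncur F p = uncurry F (remQuot {n G} (n H) p)

  cur-uncur : ∀ F u y → cur (uncur F) u y ≡ F u y
  cur-uncur F u y = cong (uncurry F) (remQuot-combine u y)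

  ∀-combine : ∀ {P : Fin (n (G ∘ₗ H)) → Set} → (∀ u y → P (combine u y)) → ∀ p → P p
  ∀-combine {P} P-combine p =
    subst P (combine-remQuot {n G} (n H) p) (uncurry P-combine (remQuot {n G} (n H) p))

  fibre : Labelling → Fin (n G) → ℕ
  fibre F u = ΣF (n H) (F u)

  fibreSum : (ℕ → ℕ) → Labelling → ℕ
  fibreSum φ F = ΣF (n G) (λ u → φ (fibre F u))

  total heavy : Labelling → ℕ
  total = fibreSum (λ m → m)
  heavy = fibreSum isHeavy

  fibreSum-cong : ∀ φ {F F′} → (∀ u y → F u y ≡ F′ u y) → fibreSum φ F ≡ fibreSum φ F′
  fibreSum-cong φ F≗F′ = ΣF-cong (n G) λ u → cong φ (ΣF-cong (n H) (F≗F′ u))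

  weight-cur : ∀ f → weight (G ∘ₗ H) f ≡ total (cur f)
  weight-cur = ΣF-combine (n G) (n H)

  lexNbSum : Labelling → Fin (n G) → Fin (n H) → ℕ
  lexNbSum F u y = ΣF (n G) λ x → ΣF (n H) λ y′ → if lexAdj′ G H (u , y) (x , y′) then F x y′ else 0

  nbSum-cur : ∀ f u y → nbSum (G ∘ₗ H) f (combine u y) ≡ lexNbSum (cur f) u y
  nbSum-cur f u y = trans (ΣF-combine (n G) (n H) _) (ΣF-cong (n G) λ x → ΣF-cong (n H) λ y′ →
    cong₂ (λ p q → if lexAdj′ G H p q then f (combine x y′) else 0) (remQuot-combine u y) (remQuot-combine x y′))

  lexNbSum-split : ∀ F u y → lexNbSum F u y ≡ nbSum G (fibre F) u + nbSum H (F u) y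
  lexNbSum-split F u y = begin
    lexNbSum F u y                                     ≡⟨ ΣF-cong (n G) term ⟩
    ΣF (n G) (outer [ u ≔ nbSum H (F u) y ])           ≡⟨ +-identityʳ _ ⟨
    ΣF (n G) (outer [ u ≔ nbSum H (F u) y ]) + 0       ≡⟨ cong (ΣF (n G) (outer [ u ≔ _ ]) +_) outerᵤ ⟨
    ΣF (n G) (outer [ u ≔ nbSum H (F u) y ]) + outer u ≡⟨ ΣF-[≔] (λ m → m) outer u _ ⟩
    nbSum G (fibre F) u + nbSum H (F u) y              ∎
    where
    open ≡-Reasoning
    outer : Fin (n G) → ℕ
    outer x = if adj G u x then fibre F x else 0
    outerᵤ : outer u ≡ 0
    outerᵤ rewrite irrefl G u = refl
    term : ∀ x → ΣF (n H) (λ y′ → if lexAdj′ G H (u , y) (x , y′) then F x y′ else 0)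
               ≡ (outer [ u ≔ nbSum H (F u) y ]) x
    term x with x Fin.≟ u
    ... | yes refl rewrite updateAt-updates x {const (nbSum H (F x) y)} outer | irrefl G x | eqF-refl x = refl
    ... | no x≢u rewrite updateAt-minimal x u {const (nbSum H (F u) y)} outer x≢u with adj G u x
    ...   | true  = refl
    ...   | false rewrite eqF-false (x≢u ∘ sym) = ΣF-zero (n H)

  lexNbSum-≥G : ∀ F u y → nbSum G (fibre F) u ≤ lexNbSum F u y
  lexNbSum-≥G F u y = subst (_ ≤_) (sym (lexNbSum-split F u y)) (m≤m+n _ _)

  lexNbSum-mono : ∀ {F F′} → (∀ u y → F u y ≤ F′ u y) → ∀ u y → lexNbSum F u y ≤ lexNbSum F′ u y
  lexNbSum-mono F≤F′ u y =
    ΣF-mono (n G) λ x → ΣF-mono (n H) λ y′ → if-mono (lexAdj′ G H (u , y) (x , y′)) (F≤F′ x y′)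
    where
    if-mono : ∀ b {m m′} → m ≤ m′ → (if b then m else 0) ≤ (if b then m′ else 0)
    if-mono true  m≤m′ = m≤m′
    if-mono false _    = z≤n

  IsLexIDF : Labelling → Set
  IsLexIDF F = (∀ u y → F u y ≤ 2) × (∀ u y → F u y ≡ 0 → 2 ≤ lexNbSum F u y)

  IsLexIDF-raise : ∀ {F F′} → (∀ u y → F u y ≤ F′ u y) → (∀ u y → F′ u y ≤ 2) →
                   IsLexIDF F → IsLexIDF F′
  IsLexIDF-raise F≤F′ bounded′ (_ , dominated) = bounded′ , λ u y F′uy≡0 →
    ≤-trans (dominated u y (n≤0⇒n≡0 (≤-trans (F≤F′ u y) (≤-reflexive F′uy≡0))))
            (lexNbSum-mono F≤F′ u y)

  IDF⇒lexIDF : ∀ {f} → IsIDF (G ∘ₗ H) f → IsLexIDF (cur f)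
  IDF⇒lexIDF {f} (bounded , dominated) =
    (λ u y → bounded (combine u y)) ,
    (λ u y fuy≡0 → subst (2 ≤_) (nbSum-cur f u y) (dominated (combine u y) fuy≡0))

  lexIDF⇒IDF : ∀ {f} → IsLexIDF (cur f) → IsIDF (G ∘ₗ H) f
  lexIDF⇒IDF {f} (bounded , dominated) =
    ∀-combine {λ p → f p ≤ 2} bounded ,
    ∀-combine {λ p → f p ≡ 0 → 2 ≤ nbSum (G ∘ₗ H) f p} λ u y fuy≡0 →
      subst (2 ≤_) (sym (nbSum-cur f u y)) (dominated u y fuy≡0)

  uncur-IDF : ∀ {F} → IsLexIDF F → IsIDF (G ∘ₗ H) (uncur F)
  uncur-IDF {F} idf = lexIDF⇒IDF (IsLexIDF-raise
    (λ u y → ≤-reflexive (sym (cur-uncur F u y)))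
    (λ u y → subst (_≤ 2) (sym (cur-uncur F u y)) (proj₁ idf u y)) idf)

  replaceFibre-IDF : ∀ {F} u {g} → IsLexIDF F → (∀ z → g z ≤ 2) → 2 ≤ ΣF (n H) g →
                     (∀ z → g z ≡ 0 → 2 ≤ lexNbSum (F [ u ≔ g ]) u z) → IsLexIDF (F [ u ≔ g ])
  replaceFibre-IDF {F} u {g} (bounded , dominated) g≤2 2≤Σg g-dominated =
    [≔]-elim (λ _ k → ∀ z → k z ≤ 2) F u g g≤2 (λ w _ → bounded w) ,
    [≔]-elim (λ w k → ∀ z → k z ≡ 0 → 2 ≤ lexNbSum F′ w z) F u g g-dominated off-u
    where
    F′ = F [ u ≔ g ]
    F′-off : ∀ {v} → v ≢ u → F′ v ≡ F v
    F′-off {v} v≢u = updateAt-minimal v u F v≢u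
    off-u : ∀ w → w ≢ u → ∀ z → F w z ≡ 0 → 2 ≤ lexNbSum F′ w z
    off-u w w≢u z Fwz≡0 with adj G w u in wu
    ... | true  = begin
      2                    ≤⟨ 2≤Σg ⟩
      ΣF (n H) g           ≡⟨ cong (ΣF (n H)) (updateAt-updates u F) ⟨
      fibre F′ u           ≤⟨ neighbour≤nbSum G (fibre F′) wu ⟩
      nbSum G (fibre F′) w ≤⟨ lexNbSum-≥G F′ w z ⟩
      lexNbSum F′ w z      ∎
      where open ≤-Reasoning
    ... | false = begin
      2                                       ≤⟨ dominated w z Fwz≡0 ⟩
      lexNbSum F w z                          ≡⟨ lexNbSum-split F w z ⟩
      nbSum G (fibre F) w + nbSum H (F w) z   ≡⟨ cong₂ _+_ fibres-unchanged fibre-unchanged ⟨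
      nbSum G (fibre F′) w + nbSum H (F′ w) z ≡⟨ lexNbSum-split F′ w z ⟨
      lexNbSum F′ w z                         ∎
      where
      open ≤-Reasoning
      fibres-unchanged : nbSum G (fibre F′) w ≡ nbSum G (fibre F) w
      fibres-unchanged = nbSum-cong G w λ x wx → cong (ΣF (n H)) (F′-off (adj-≢ G wx wu))
      fibre-unchanged : nbSum H (F′ w) z ≡ nbSum H (F w) z
      fibre-unchanged = cong (λ k → nbSum H k z) (F′-off w≢u)

  fibreSum-[≔] : ∀ φ F u g → fibreSum φ (F [ u ≔ g ]) + φ (fibre F u) ≡ fibreSum φ F + φ (ΣF (n H) g)
  fibreSum-[≔] φ = ΣF-[≔] (φ ∘ ΣF (n H))

  fibreSum-exchange : ∀ φ F {u x} → u ≢ x → ∀ g h →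
    fibreSum φ (F [ x ≔ h ] [ u ≔ g ]) + (φ (fibre F u) + φ (fibre F x))
      ≡ fibreSum φ F + (φ (ΣF (n H) g) + φ (ΣF (n H) h))
  fibreSum-exchange φ F {u} {x} u≢x g h = begin
    S′ + (φ (fibre F u) + φ (fibre F x)) ≡⟨ +-assoc S′ _ _ ⟨
    S′ + φ (fibre F u) + φ (fibre F x)   ≡⟨ cong (λ k → S′ + φ (ΣF (n H) k) + _) (updateAt-minimal u x F u≢x) ⟨
    S′ + φ (fibre F₁ u) + φ (fibre F x)  ≡⟨ cong (_+ φ (fibre F x)) (fibreSum-[≔] φ F₁ u g) ⟩
    S₁ + φ (ΣF (n H) g) + φ (fibre F x)  ≡⟨ swap S₁ _ _ ⟩
    S₁ + φ (fibre F x) + φ (ΣF (n H) g)  ≡⟨ cong (_+ φ (ΣF (n H) g)) (fibreSum-[≔] φ F x h) ⟩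
    S + φ (ΣF (n H) h) + φ (ΣF (n H) g)  ≡⟨ swap-assoc S _ _ ⟩
    S + (φ (ΣF (n H) g) + φ (ΣF (n H) h)) ∎
    where
    open ≡-Reasoning
    F₁ = F [ x ≔ h ]
    S′ = fibreSum φ (F₁ [ u ≔ g ])
    S₁ = fibreSum φ F₁
    S  = fibreSum φ F
    swap : ∀ a b c → a + b + c ≡ a + c + b
    swap = solve-∀
    swap-assoc : ∀ a b c → a + b + c ≡ a + (c + b)
    swap-assoc = solve-∀

  Improvement : Labelling → Set
  Improvement F = Σ Labelling λ F′ → IsLexIDF F′ × total F′ ≤ total F × heavy F′ < heavy F

  exchange-improves : ∀ {F u x g h} → IsLexIDF F → adj G u x ≡ true → 3 ≤ fibre F u →
    (∀ z → F x z ≤ h z) → (∀ z → h z ≤ 2) → isHeavy (ΣF (n H) h) ≤ isHeavy (fibre F x) →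
    (∀ z → g z ≤ 2) → ΣF (n H) g ≡ 2 → (∀ z → g z ≡ 0 → 2 ≤ lexNbSum (F [ x ≔ h ] [ u ≔ g ]) u z) →
    2 + ΣF (n H) h ≤ fibre F u + fibre F x → Improvement F
  exchange-improves {F} {u} {x} {g} {h} idf ux 3≤fᵤ F≤h h≤2 heavyₕ g≤2 Σg≡2 g-dominated budget =
    F [ x ≔ h ] [ u ≔ g ] ,
    replaceFibre-IDF u (IsLexIDF-raise raised bounded₁ idf) g≤2 (≤-reflexive (sym Σg≡2)) g-dominated ,
    +-balance-≤ (fibreSum-exchange (λ m → m) F u≢x g h)
                (subst (λ m → m + ΣF (n H) h ≤ _) (sym Σg≡2) budget) ,
    +-balance-< (fibreSum-exchange isHeavy F u≢x g h) heavy-budget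
    where
    u≢x = adj⇒≢ G ux
    raised : ∀ w z → F w z ≤ (F [ x ≔ h ]) w z
    raised = [≔]-elim (λ w k → ∀ z → F w z ≤ k z) F x h F≤h (λ _ _ _ → ≤-refl)
    bounded₁ : ∀ w z → (F [ x ≔ h ]) w z ≤ 2
    bounded₁ = [≔]-elim (λ _ k → ∀ z → k z ≤ 2) F x h h≤2 (λ w _ → proj₁ idf w)
    heavy-budget : isHeavy (ΣF (n H) g) + isHeavy (ΣF (n H) h) < isHeavy (fibre F u) + isHeavy (fibre F x)
    heavy-budget rewrite Σg≡2 | isHeavy-≥3 3≤fᵤ = s≤s heavyₕ

  module HeavyFibre {F : Labelling} (idf : IsLexIDF F) {u : Fin (n G)} (3≤fᵤ : 3 ≤ fibre F u) where

    lexNbSum-exchange-≥ : ∀ {x} → adj G u x ≡ true → ∀ g h z →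
                          nbSum H g z + ΣF (n H) h ≤ lexNbSum (F [ x ≔ h ] [ u ≔ g ]) u z
    lexNbSum-exchange-≥ {x} ux g h z = begin
      nbSum H g z + ΣF (n H) h                ≡⟨ +-comm _ (ΣF (n H) h) ⟩
      ΣF (n H) h + nbSum H g z                ≡⟨ cong₂ (λ k k′ → ΣF (n H) k + nbSum H k′ z) F′ₓ≡h F′ᵤ≡g ⟨
      fibre F′ x + nbSum H (F′ u) z           ≤⟨ +-monoˡ-≤ _ (neighbour≤nbSum G (fibre F′) ux) ⟩
      nbSum G (fibre F′) u + nbSum H (F′ u) z ≡⟨ lexNbSum-split F′ u z ⟨
      lexNbSum F′ u z                         ∎
      where
      open ≤-Reasoning
      F′ = F [ x ≔ h ] [ u ≔ g ]
      F′ᵤ≡g : F′ u ≡ g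
      F′ᵤ≡g = updateAt-updates u (F [ x ≔ h ])
      F′ₓ≡h : F′ x ≡ h
      F′ₓ≡h = trans (updateAt-minimal x u (F [ x ≔ h ]) (adj⇒≢ G ux ∘ sym)) (updateAt-updates x F)

    2+fₓ≤fᵤ+fₓ : ∀ x → 2 + fibre F x ≤ fibre F u + fibre F x
    2+fₓ≤fᵤ+fₓ x = +-monoˡ-≤ (fibre F x) (≤-trans (n≤1+n 2) 3≤fᵤ)

    neighbourhood-improves : ∀ {x} → adj G u x ≡ true → 2 ≤ nbSum G (fibre F) u → Fin (n H) → Improvement F
    neighbourhood-improves {x} ux 2≤Nᵤ y₀ =
      exchange-improves idf ux 3≤fᵤ (λ _ → ≤-refl) (proj₁ idf x) ≤-refl
        (point≤ y₀ 2) (ΣF-point (n H) y₀ 2) dominated (2+fₓ≤fᵤ+fₓ x)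
      where
      F′ = F [ x ≔ F x ] [ u ≔ point y₀ 2 ]
      unchanged : ∀ {w} → w ≢ u → fibre F w ≡ fibre F′ w
      unchanged {w} w≢u =
        cong (ΣF (n H)) (sym (trans (updateAt-minimal w u _ w≢u) (updateAt-id-local x F refl w)))
      dominated : ∀ z → point y₀ 2 z ≡ 0 → 2 ≤ lexNbSum F′ u z
      dominated z _ = begin
        2                    ≤⟨ 2≤Nᵤ ⟩
        nbSum G (fibre F) u  ≡⟨ nbSum-cong G u (λ w uw → unchanged (adj⇒≢ G uw ∘ sym)) ⟩
        nbSum G (fibre F′) u ≤⟨ lexNbSum-≥G F′ u z ⟩
        lexNbSum F′ u z      ∎
        where open ≤-Reasoning

    concentrated-improves : ∀ {x y} → adj G u x ≡ true → fibre F x ≡ F x y → 4 ≤ fibre F u + fibre F x →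
                            Fin (n H) → Improvement F
    concentrated-improves {x} {y} ux fₓ≡Fxy 4≤fᵤ+fₓ y₀ =
      exchange-improves idf ux 3≤fᵤ F≤h h≤2 (subst (λ m → isHeavy m ≤ _) (sym Σh≡2) z≤n)
        (point≤ y₀ 2) (ΣF-point (n H) y₀ 2) dominated (subst (λ m → 2 + m ≤ _) (sym Σh≡2) 4≤fᵤ+fₓ)
      where
      h = F x [ y ≔ 2 ]
      F≤h = [≔]-elim (λ z m → F x z ≤ m) (F x) y 2 (proj₁ idf x y) (λ _ _ → ≤-refl)
      h≤2 = [≔]-elim (λ _ m → m ≤ 2) (F x) y 2 ≤-refl (λ z _ → proj₁ idf x z)
      Σh≡2 : ΣF (n H) h ≡ 2
      Σh≡2 = ΣF-[≔]-concentrated (n H) (F x) y 2 fₓ≡Fxy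
      dominated : ∀ z → point y₀ 2 z ≡ 0 → 2 ≤ lexNbSum (F [ x ≔ h ] [ u ≔ point y₀ 2 ]) u z
      dominated z _ =
        ≤-trans (≤-reflexive (sym Σh≡2)) (≤-trans (m≤n+m _ _) (lexNbSum-exchange-≥ ux (point y₀ 2) h z))

    smallIDF-improves : ∀ {x g} → adj G u x ≡ true → 2 ≤ n H → IsIDF H g → weight H g ≤ 2 → Improvement F
    smallIDF-improves {x} {g} ux 2≤nH idfᵍ wg≤2 =
      exchange-improves idf ux 3≤fᵤ (λ _ → ≤-refl) (proj₁ idf x) ≤-refl
        (proj₁ idfᵍ) Σg≡2 dominated (2+fₓ≤fᵤ+fₓ x)
      where
      Σg≡2 = ≤-antisym wg≤2 (IDF-weight≥2 H 2≤nH idfᵍ)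
      dominated : ∀ z → g z ≡ 0 → 2 ≤ lexNbSum (F [ x ≔ F x ] [ u ≔ g ]) u z
      dominated z gz≡0 =
        ≤-trans (proj₂ idfᵍ z gz≡0) (≤-trans (m≤m+n _ _) (lexNbSum-exchange-≥ ux g (F x) z))

    smallDominating-improves : ∀ {x D} → adj G u x ≡ true → fibre F x ≡ 0 → Fin (n H) →
                               IsDominating H D → card H D ≡ 2 → Improvement F
    smallDominating-improves {x} {D} ux fₓ≡0 y₀ dom |D|≡2 =
      exchange-improves idf ux 3≤fᵤ F≤h h≤2 (subst (λ m → isHeavy m ≤ _) (sym Σh≡1) z≤n)
        g≤2 |D|≡2 dominated budget
      where
      Fxy₀≡0 : F x y₀ ≡ 0
      Fxy₀≡0 = n≤0⇒n≡0 (≤-trans (term≤ΣF (n H) (F x) y₀) (≤-reflexive fₓ≡0))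
      g : Fin (n H) → ℕ
      g z = if D z then 1 else 0
      h = F x [ y₀ ≔ 1 ]
      F≤h = [≔]-elim (λ z m → F x z ≤ m) (F x) y₀ 1 (≤-trans (≤-reflexive Fxy₀≡0) z≤n)
                     (λ _ _ → ≤-refl)
      h≤2 = [≔]-elim (λ _ m → m ≤ 2) (F x) y₀ 1 (s≤s z≤n) (λ z _ → proj₁ idf x z)
      Σh≡1 : ΣF (n H) h ≡ 1
      Σh≡1 = ΣF-[≔]-concentrated (n H) (F x) y₀ 1 (trans fₓ≡0 (sym Fxy₀≡0))
      g≤2 : ∀ z → g z ≤ 2
      g≤2 z with D z
      ... | true  = s≤s z≤n
      ... | false = z≤n
      dominated : ∀ z → g z ≡ 0 → 2 ≤ lexNbSum (F [ x ≔ h ] [ u ≔ g ]) u z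
      dominated z gz≡0 with D z in Dz
      ... | false with dom z Dz
      ...   | b , zb , Db = ≤-trans (+-mono-≤ 1≤nbSum (≤-reflexive (sym Σh≡1))) (lexNbSum-exchange-≥ ux g h z)
        where
        1≤nbSum : 1 ≤ nbSum H g z
        1≤nbSum = ≤-trans (≤-reflexive (cong (if_then 1 else 0) (sym Db))) (neighbour≤nbSum H g zb)
      budget : 2 + ΣF (n H) h ≤ fibre F u + fibre F x
      budget rewrite Σh≡1 | fₓ≡0 | +-identityʳ (fibre F u) = 3≤fᵤ

    lightNeighbour-improves : nbSum G (fibre F) u ≡ 1 → Fin (n H) → Improvement F
    lightNeighbour-improves Nᵤ≡1 y₀ with nbSum-positive G (fibre F) u (≤-reflexive (sym Nᵤ≡1))
    ... | x , ux , 1≤fₓ with ΣF-positive (n H) (F x) 1≤fₓ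
    ...   | y , 1≤Fxy = concentrated-improves ux fₓ≡Fxy (+-mono-≤ 3≤fᵤ 1≤fₓ) y₀
      where
      fₓ≤1 = ≤-trans (neighbour≤nbSum G (fibre F) ux) (≤-reflexive Nᵤ≡1)
      fₓ≡Fxy = ≤-antisym (≤-trans fₓ≤1 1≤Fxy) (term≤ΣF (n H) (F x) y)

    module _ (noImp : ¬ Improvement F) {x : Fin (n G)} (ux : adj G u x ≡ true) (2≤nH : 2 ≤ n H) where

      italian≥3 : ∀ {g} → IsIDF H g → 3 ≤ weight H g
      italian≥3 {g} idfᵍ with 3 ≤? weight H g
      ... | yes 3≤w = 3≤w
      ... | no  3≰w = contradiction (smallIDF-improves ux 2≤nH idfᵍ (≤-pred (≰⇒> 3≰w))) noImp

      domination≥3 : fibre F x ≡ 0 → ∀ {D} → IsDominating H D → 3 ≤ card H D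
      domination≥3 fₓ≡0 {D} dom with card H D in |D|
      ... | suc (suc (suc _)) = s≤s (s≤s (s≤s z≤n))
      ... | suc (suc zero)    =
        contradiction (smallDominating-improves ux fₓ≡0 (proj₁ (twoVertices 2≤nH)) dom |D|) noImp
      ... | suc zero          = contradiction
        (smallIDF-improves ux 2≤nH (twoOn-IDF H dom) (twoOn-weight≤2 H D (≤-reflexive |D|))) noImp
      ... | zero              = contradiction
        (smallIDF-improves ux 2≤nH (twoOn-IDF H dom) (twoOn-weight≤2 H D (≤-trans (≤-reflexive |D|) z≤n))) noImp

      isolated⇒numbers≡3 : nbSum G (fibre F) u ≡ 0 → ItalianDominationNumber H 3 × DominationNumber H 3
      isolated⇒numbers≡3 Nᵤ≡0 = byWeight (4 ≤? fibre F u)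
        where
        y₀ = proj₁ (twoVertices 2≤nH)
        fₓ≡0 : fibre F x ≡ 0
        fₓ≡0 = n≤0⇒n≡0 (≤-trans (neighbour≤nbSum G (fibre F) ux) (≤-reflexive Nᵤ≡0))
        Fxy₀≡0 : F x y₀ ≡ 0
        Fxy₀≡0 = n≤0⇒n≡0 (≤-trans (term≤ΣF (n H) (F x) y₀) (≤-reflexive fₓ≡0))
        idfᵤ : IsIDF H (F u)
        idfᵤ = proj₁ idf u , λ z Fuz≡0 →
          subst (2 ≤_) (trans (lexNbSum-split F u z) (cong (_+ nbSum H (F u) z) Nᵤ≡0)) (proj₂ idf u z Fuz≡0)
        byWeight : Dec (4 ≤ fibre F u) → ItalianDominationNumber H 3 × DominationNumber H 3
        byWeight (yes 4≤fᵤ) = contradiction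
          (concentrated-improves ux (trans fₓ≡0 (sym Fxy₀≡0)) (≤-trans 4≤fᵤ (m≤m+n _ _)) y₀) noImp
        byWeight (no 4≰fᵤ) =
          (F u , (idfᵤ , λ g idfᵍ → subst (_≤ weight H g) (sym fᵤ≡3) (italian≥3 idfᵍ)) , fᵤ≡3) ,
          (support H (F u) , support-dominating H idfᵤ , |support|≡3 , λ D dom → domination≥3 fₓ≡0 dom)
          where
          fᵤ≡3 : fibre F u ≡ 3
          fᵤ≡3 = ≤-antisym (≤-pred (≰⇒> 4≰fᵤ)) 3≤fᵤ
          |support|≡3 : card H (support H (F u)) ≡ 3
          |support|≡3 = ≤-antisym (≤-trans (card-support≤weight H (F u)) (≤-reflexive fᵤ≡3))
                                  (domination≥3 fₓ≡0 (support-dominating H idfᵤ))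

    unimprovable⇒numbers≡3 : ¬ Improvement F → NoIsolatedVertex G → 2 ≤ n H →
                             ItalianDominationNumber H 3 × DominationNumber H 3
    unimprovable⇒numbers≡3 noImp noIso 2≤nH = byNeighbourhood (nbSum G (fibre F) u) refl
      where
      ux = proj₂ (noIso u)
      y₀ = proj₁ (twoVertices 2≤nH)
      byNeighbourhood : ∀ m → nbSum G (fibre F) u ≡ m → ItalianDominationNumber H 3 × DominationNumber H 3
      byNeighbourhood (suc (suc m)) Nᵤ =
        contradiction (neighbourhood-improves ux (subst (2 ≤_) (sym Nᵤ) (s≤s (s≤s z≤n))) y₀) noImp
      byNeighbourhood 1 Nᵤ = contradiction (lightNeighbour-improves Nᵤ y₀) noImp
      byNeighbourhood 0 Nᵤ = isolated⇒numbers≡3 noImp ux 2≤nH Nᵤ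

  lightFibres : NoIsolatedVertex G → 2 ≤ n H → (¬ ItalianDominationNumber H 3 ⊎ ¬ DominationNumber H 3) →
                ∀ {F} → IsLexIDF F → ¬ Improvement F → ∀ u → fibre F u ≤ 2
  lightFibres noIso 2≤nH not-both {F} idf noImp u with 3 ≤? fibre F u
  ... | no  3≰fᵤ = ≤-pred (≰⇒> 3≰fᵤ)
  ... | yes 3≤fᵤ = let γI≡3 , γ≡3 = HeavyFibre.unimprovable⇒numbers≡3 idf 3≤fᵤ noImp noIso 2≤nH
                   in ⊥-elim ([ (λ ¬γI≡3 → ¬γI≡3 γI≡3) , (λ ¬γ≡3 → ¬γ≡3 γ≡3) ] not-both)

  unimprovableMinIDF : Σ (Fin (n (G ∘ₗ H)) → ℕ) λ f → IsMinIDF (G ∘ₗ H) f × ¬ Improvement (cur f)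
  unimprovableMinIDF
    with argmin-bounded 2 (isIDF? (G ∘ₗ H)) (IsIDF-cong (G ∘ₗ H)) proj₁ (weight (G ∘ₗ H)) (ΣF-cong _)
                          ((λ _ → 2) , (λ _ → ≤-refl) , λ _ ())
  ... | f₀ , idf₀ , minimum
    with argmin-bounded 2 (λ f → isIDF? (G ∘ₗ H) f ×-dec weight (G ∘ₗ H) f ≤? weight (G ∘ₗ H) f₀)
                          (λ f≗g (idf , w≤) →
                             IsIDF-cong (G ∘ₗ H) f≗g idf , subst (_≤ _) (ΣF-cong _ f≗g) w≤)
                          (proj₁ ∘ proj₁)
                          (heavy ∘ cur) (λ f≗g → fibreSum-cong isHeavy λ u y → f≗g (combine u y))
                          (f₀ , idf₀ , ≤-refl)
  ...   | f , (idf , w≤w₀) , fewest = f , (idf , λ g idfᵍ → ≤-trans w≤w₀ (minimum g idfᵍ)) , noImp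
    where
    noImp : ¬ Improvement (cur f)
    noImp (F′ , idf′ , total≤ , heavy<) =
      <⇒≱ heavy< (subst (heavy (cur f) ≤_) (fibreSum-cong isHeavy (cur-uncur F′))
                                          (fewest (uncur F′) (uncur-IDF idf′ , w′≤w₀)))
      where
      w′≤w₀ : weight (G ∘ₗ H) (uncur F′) ≤ weight (G ∘ₗ H) f₀
      w′≤w₀ = begin
        weight (G ∘ₗ H) (uncur F′) ≡⟨ weight-cur (uncur F′) ⟩
        total (cur (uncur F′))      ≡⟨ fibreSum-cong (λ m → m) (cur-uncur F′) ⟩
        total F′                    ≤⟨ total≤ ⟩
        total (cur f)               ≡⟨ weight-cur f ⟨
        weight (G ∘ₗ H) f           ≤⟨ w≤w₀ ⟩
        weight (G ∘ₗ H) f₀          ∎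
        where open ≤-Reasoning

lemma2p1 : (G H : Graph) → NoIsolatedVertex G → 2 ≤ n H
    → (¬ ItalianDominationNumber H 3 ⊎ ¬ DominationNumber H 3)
    → Σ (Fin (n (G ∘ₗ H)) → ℕ) λ f → IsMinIDF (G ∘ₗ H) f
    × (∀ (u : Fin (n G)) → ΣF (n H) (λ y → f (combine u y)) ≤ 2)
lemma2p1 G H noIso 2≤nH not-both =
  let f , minIDF , noImp = unimprovableMinIDF
  in f , minIDF , lightFibres noIso 2≤nH not-both (IDF⇒lexIDF (proj₁ minIDF)) noImp
  where open LexProduct G H
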